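{- Let $m\in\mathbb{Q}$ and $n\geq 2$, and let $f^{(n)}_m(X)$ be as defined in the context. If there exists a prime $p\neq 3$ such that $v_p(m^2+m+1)=1$, then $v_p\left(f^{(n)}_m(m)\right)=1$.
   Context: For a rational number $m$ define $g:\mathbb{N}\to\mathbb{Q}$ by $g(i)=1,\,-m,\,-m-1,\,-1,\,m,\,m+1$ according as $i\equiv 0,1,2,3,4,5 \pmod 6$. For $n\geq 0$ put $f^{(n)}_m(X)=\sum_{i=0}^{n}\binom{n}{i}X^i g(n-i)$. Here $v_p(x)$ denotes the $p$-adic valuation of a rational number $x$. -}

module Defs where

open import Data.Nat as ℕ using (ℕ; zero; suc; _∸_)
open import Data.Nat.Divisibility using (_∣_)
open import Data.Nat.Combinatorics using (_C_)
open import Data.Integer as ℤ using (ℤ; +_; -[1+_])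
open import Data.Rational as ℚ using (ℚ; _+_; _*_; -_; 0ℚ; 1ℚ)
open import Data.Product using (_×_)
open import Relation.Nullary using (¬_)
open import Relation.Binary.PropositionalEquality using (_≡_)

_^ℚ_ : ℚ → ℕ → ℚ
x ^ℚ zero  = 1ℚ
x ^ℚ suc k = x * (x ^ℚ k)

natℚ : ℕ → ℚ
natℚ n = (+ n) ℚ./ 1

g : ℚ → ℕ → ℚ
g m 0 = 1ℚ
g m 1 = - m
g m 2 = - (m + 1ℚ)
g m 3 = - 1ℚ
g m 4 = m
g m 5 = m + 1ℚ
g m (suc (suc (suc (suc (suc (suc i)))))) = g m i

sumTo : ℕ → (ℕ → ℚ) → ℚ
sumTo zero    t = t 0
sumTo (suc k) t = sumTo k t + t (suc k)

f : ℕ → ℚ → ℚ → ℚ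
f n m X = sumTo n (λ i → natℚ (n C i) * ((X ^ℚ i) * g m (n ∸ i)))

-- p-adic valuation of a rational: HasValuation p x k  means  x ≠ 0 and v_p(x) = k.
-- Written via the reduced form x = a/b (b > 0, gcd(a,b)=1):
--   v_p(x) = j ≥ 0   iff p^j ∣ a, p^{j+1} ∤ a, p ∤ b
--   v_p(x) = -(j+1)  iff p ∤ a, p^{j+1} ∣ b, p^{j+2} ∤ b
HasValuation : ℕ → ℚ → ℤ → Set
HasValuation p x (+ j) =
  ¬ (x ≡ 0ℚ) ×
  ((p ℕ.^ j) ∣ ℤ.∣ ℚ.numerator x ∣) × ¬ ((p ℕ.^ suc j) ∣ ℤ.∣ ℚ.numerator x ∣) ×
  ¬ (p ∣ ℚ.denominatorℕ x)
HasValuation p x -[1+ j ] =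
  ¬ (x ≡ 0ℚ) ×
  ¬ (p ∣ ℤ.∣ ℚ.numerator x ∣) ×
  ((p ℕ.^ suc j) ∣ ℚ.denominatorℕ x) × ¬ ((p ℕ.^ suc (suc j)) ∣ ℚ.denominatorℕ x)

-- Since g (i+2) = g (i+1) − g i, Pascal's rule gives the recurrence
-- F (n+2) = (2m+1) F (n+1) − (m²+m+1) F n for F n = f^{(n)}_m(m), with F 1 = 0 and
-- F 2 = −(m²+m+1). Write m = a/d in lowest terms, P = 2a+d and Q = a²+ad+d². Clearing
-- denominators, d^{n+1} F (n+1) = −Q U n, where U is the Lucas sequence of (P, Q).
-- If v_p(m²+m+1) = 1 then p ∤ d and v_p(Q) = 1; as P² + 3d² = 4Q and p ≠ 3, p ∤ P,
-- and U (n+2) ≡ P U (n+1) (mod p) shows p ∤ U (n+1). Hence v_p(F (n+2)) = v_p(Q) = 1.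

module Submission where

open import Defs
open import Data.Nat using (ℕ; _≥_)
open import Data.Nat.Primality using (Prime)
open import Data.Integer using (+_)
open import Data.Rational using (ℚ; _+_; _*_; 1ℚ)
open import Relation.Binary.PropositionalEquality using (_≢_)

open import Level using (0ℓ)
open import Function.Base using (id; _∘_)
open import Data.List.Base using ([]; _∷_)
open import Data.Product using (_×_; _,_; proj₁; proj₂)
open import Data.Sum as Sum using (_⊎_; [_,_]′)
open import Relation.Nullary.Negation using (¬_; contradiction)
open import Relation.Nullary.Decidable.Core using (dec⇒maybe; from-yes)
open import Relation.Binary.PropositionalEquality
open ≡-Reasoning

open import Data.Nat as ℕ using (zero; suc; _∸_; _≤_; z≤n; s≤s)
import Data.Nat.Properties as ℕ
import Data.Nat.Divisibility as ℕ
import Data.Nat.Coprimality as Coprimality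
open import Data.Nat.Primality
  using (euclidsLemma; prime⇒nonZero; prime⇒nonTrivial; prime⇒irreducible; prime?)
open import Data.Nat.Combinatorics using (_C_; nCk+nC[k+1]≡[n+1]C[k+1]; k>n⇒nCk≡0)
open import Data.Integer as ℤ using (ℤ)
import Data.Integer.Properties as ℤ
open import Data.Integer.Divisibility.Signed
  using ( _∣_; divides; ∣ᵤ⇒∣; ∣⇒∣ᵤ; ∣-refl; ∣-trans; ∣m⇒∣m*n; ∣n⇒∣m*n; ∣m⇒∣-m
        ; ∣m∣n⇒∣m+n; ∣m+n∣n⇒∣m; ∣m+n∣m⇒∣n; *-cancelʳ-∣; *-monoˡ-∣)
open import Data.Rational as ℚ using (mkℚ; _/_; _-_; -_; 0ℚ; ↥_; ↧_; toℚᵘ)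
open import Data.Rational.Properties
  using ( +-*-commutativeRing; +-0-commutativeMonoid
        ; +-assoc; +-identityʳ; *-zeroˡ; *-zeroʳ; neg-distrib-+; *-distribˡ-+; p≡0⇒↥p≡0
        ; toℚᵘ-injective; toℚᵘ-fromℚᵘ; toℚᵘ-homo-*; toℚᵘ-homo-+; toℚᵘ-homo‿-)
open import Data.Rational.Unnormalised as ℚᵘ using (mkℚᵘ; *≡*) renaming (_≃_ to _≃ᵘ_)
import Data.Rational.Unnormalised.Properties as ℚᵘ
open import Algebra.Bundles using (CommutativeMonoid)
open import Algebra.Properties.CommutativeSemigroup
  (CommutativeMonoid.commutativeSemigroup +-0-commutativeMonoid)
  using () renaming (interchange to +-interchange)
open import Tactic.RingSolver using (solve-∀; solve)
import Tactic.RingSolver.Core.AlmostCommutativeRing as ACR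
import Data.Integer.Tactic.RingSolver as ℤ-Solver

ℚ-ring : ACR.AlmostCommutativeRing 0ℓ 0ℓ
ℚ-ring = ACR.fromCommutativeRing +-*-commutativeRing (λ x → dec⇒maybe (0ℚ ℚ.≟ x))

ι : ℤ → ℚ
ι i = i / 1

toℚᵘ-ι : ∀ i → toℚᵘ (ι i) ≃ᵘ mkℚᵘ i 0
toℚᵘ-ι i = toℚᵘ-fromℚᵘ (mkℚᵘ i 0)

≃ᵘ⇒ι≡ : ∀ i {q : ℚ} → mkℚᵘ i 0 ≃ᵘ toℚᵘ q → ι i ≡ q
≃ᵘ⇒ι≡ i e = toℚᵘ-injective (ℚᵘ.≃-trans (toℚᵘ-ι i) e)

ι-homo-* : ∀ i j → ι (i ℤ.* j) ≡ ι i * ι j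
ι-homo-* i j = ≃ᵘ⇒ι≡ (i ℤ.* j) (ℚᵘ.≃-trans
  (ℚᵘ.*-cong (ℚᵘ.≃-sym (toℚᵘ-ι i)) (ℚᵘ.≃-sym (toℚᵘ-ι j)))
  (ℚᵘ.≃-sym (toℚᵘ-homo-* (ι i) (ι j))))

ι-homo-+ : ∀ i j → ι (i ℤ.+ j) ≡ ι i + ι j
ι-homo-+ i j = ≃ᵘ⇒ι≡ (i ℤ.+ j) (ℚᵘ.≃-trans {j = mkℚᵘ i 0 ℚᵘ.+ mkℚᵘ j 0} (*≡* cross) (ℚᵘ.≃-trans
  (ℚᵘ.+-cong (ℚᵘ.≃-sym (toℚᵘ-ι i)) (ℚᵘ.≃-sym (toℚᵘ-ι j)))
  (ℚᵘ.≃-sym (toℚᵘ-homo-+ (ι i) (ι j)))))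
  where
  cross : (i ℤ.+ j) ℤ.* ℤ.1ℤ ≡ (i ℤ.* ℤ.1ℤ ℤ.+ j ℤ.* ℤ.1ℤ) ℤ.* ℤ.1ℤ
  cross = ℤ-Solver.solve (i ∷ j ∷ [])

ι-homo‿- : ∀ i → ι (ℤ.- i) ≡ - ι i
ι-homo‿- i = ≃ᵘ⇒ι≡ (ℤ.- i)
  (ℚᵘ.≃-trans (ℚᵘ.-‿cong (ℚᵘ.≃-sym (toℚᵘ-ι i))) (ℚᵘ.≃-sym (toℚᵘ-homo‿- (ι i))))

ι-homo-- : ∀ i j → ι (i ℤ.- j) ≡ ι i - ι j
ι-homo-- i j = trans (ι-homo-+ i (ℤ.- j)) (cong (_+_ (ι i)) (ι-homo‿- j))

ι-homo-^ : ∀ i k → ι (i ℤ.^ k) ≡ ι i ^ℚ k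
ι-homo-^ i zero    = refl
ι-homo-^ i (suc k) = trans (ι-homo-* i (i ℤ.^ k)) (cong (ι i *_) (ι-homo-^ i k))

natℚ-homo-+ : ∀ j k → natℚ (j ℕ.+ k) ≡ natℚ j + natℚ k
natℚ-homo-+ j k = ι-homo-+ (+ j) (+ k)

toℚᵘ-*ι : ∀ x j → toℚᵘ (x * ι j) ≃ᵘ toℚᵘ x ℚᵘ.* mkℚᵘ j 0
toℚᵘ-*ι x j = ℚᵘ.≃-trans (toℚᵘ-homo-* x (ι j)) (ℚᵘ.*-congˡ {toℚᵘ x} (toℚᵘ-ι j))

*ι≡ι⇒cross : ∀ x i j → x * ι j ≡ ι i → ↥ x ℤ.* j ≡ i ℤ.* ↧ x
*ι≡ι⇒cross x@(mkℚ n d-1 _) i j eq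
  with ℚᵘ.≃-trans (ℚᵘ.≃-sym (toℚᵘ-*ι x j))
                  (ℚᵘ.≃-trans (ℚᵘ.≃-reflexive (cong toℚᵘ eq)) (toℚᵘ-ι i))
... | *≡* e = trans (sym (ℤ.*-identityʳ (n ℤ.* j)))
                    (trans e (cong (λ k → i ℤ.* + k) (ℕ.*-identityʳ (suc d-1))))

cross⇒*ι≡ι : ∀ x i j → ↥ x ℤ.* j ≡ i ℤ.* ↧ x → x * ι j ≡ ι i
cross⇒*ι≡ι x@(mkℚ n d-1 _) i j eq = toℚᵘ-injective
  (ℚᵘ.≃-trans (toℚᵘ-*ι x j) (ℚᵘ.≃-trans (*≡* e) (ℚᵘ.≃-sym (toℚᵘ-ι i))))
  where
  e : (n ℤ.* j) ℤ.* ℤ.1ℤ ≡ i ℤ.* + (suc d-1 ℕ.* 1)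
  e = trans (ℤ.*-identityʳ (n ℤ.* j))
            (trans eq (cong (λ k → i ℤ.* + k) (sym (ℕ.*-identityʳ (suc d-1)))))

*ι↧≡ι↥ : ∀ x → x * ι (↧ x) ≡ ι (↥ x)
*ι↧≡ι↥ x = cross⇒*ι≡ι x (↥ x) (↧ x) refl

sumTo-cong : ∀ n {t s : ℕ → ℚ} → (∀ i → i ≤ n → t i ≡ s i) → sumTo n t ≡ sumTo n s
sumTo-cong zero    t≡s = t≡s 0 z≤n
sumTo-cong (suc n) t≡s =
  cong₂ _+_ (sumTo-cong n (λ i i≤n → t≡s i (ℕ.m≤n⇒m≤1+n i≤n))) (t≡s (suc n) ℕ.≤-refl)

sumTo-+ : ∀ n t s → sumTo n (λ i → t i + s i) ≡ sumTo n t + sumTo n s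
sumTo-+ zero    t s = refl
sumTo-+ (suc n) t s = trans (cong (_+ (t (suc n) + s (suc n))) (sumTo-+ n t s))
                            (+-interchange (sumTo n t) (sumTo n s) (t (suc n)) (s (suc n)))

sumTo-- : ∀ n t s → sumTo n (λ i → t i - s i) ≡ sumTo n t - sumTo n s
sumTo-- n t s = trans (sumTo-+ n t (λ i → - s i)) (cong (_+_ (sumTo n t)) (sumTo-neg n))
  where
  sumTo-neg : ∀ n → sumTo n (λ i → - s i) ≡ - sumTo n s
  sumTo-neg zero    = refl
  sumTo-neg (suc n) = trans (cong (_+ - s (suc n)) (sumTo-neg n))
                            (sym (neg-distrib-+ (sumTo n s) (s (suc n))))

sumTo-* : ∀ n c t → sumTo n (λ i → c * t i) ≡ c * sumTo n t
sumTo-* zero    c t = refl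
sumTo-* (suc n) c t = trans (cong (_+ c * t (suc n)) (sumTo-* n c t))
                            (sym (*-distribˡ-+ c (sumTo n t) (t (suc n))))

sumTo-head : ∀ n t → sumTo (suc n) t ≡ t 0 + sumTo n (λ i → t (suc i))
sumTo-head zero    t = refl
sumTo-head (suc n) t = trans (cong (_+ t (suc (suc n))) (sumTo-head n t))
                             (+-assoc (t 0) (sumTo n (λ i → t (suc i))) (t (suc (suc n))))

binomialSum : (ℕ → ℚ) → ℕ → ℚ → ℚ
binomialSum h n X = sumTo n (λ i → natℚ (n C i) * ((X ^ℚ i) * h (n ∸ i)))

binomialSum-cong : ∀ {h₁ h₂} → (∀ j → h₁ j ≡ h₂ j) → ∀ n X →
  binomialSum h₁ n X ≡ binomialSum h₂ n X
binomialSum-cong h₁≡h₂ n X =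
  sumTo-cong n (λ i _ → cong (λ v → natℚ (n C i) * ((X ^ℚ i) * v)) (h₁≡h₂ (n ∸ i)))

binomialSum-- : ∀ h₁ h₂ n X →
  binomialSum (λ j → h₁ j - h₂ j) n X ≡ binomialSum h₁ n X - binomialSum h₂ n X
binomialSum-- h₁ h₂ n X = trans
  (sumTo-cong n (λ i _ → distribute (natℚ (n C i)) (X ^ℚ i) (h₁ (n ∸ i)) (h₂ (n ∸ i))))
  (sumTo-- n _ _)
  where
  distribute : ∀ c y a b → c * (y * (a - b)) ≡ c * (y * a) - c * (y * b)
  distribute = solve-∀ ℚ-ring

binomialSum-suc : ∀ h n X →
  binomialSum h (suc n) X ≡ binomialSum (λ j → h (suc j)) n X + X * binomialSum h n X
binomialSum-suc h n X = begin
  binomialSum h (suc n) X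
    ≡⟨ sumTo-head n _ ⟩
  U 0 + sumTo n (λ i → natℚ (suc n C suc i) * ((X ^ℚ suc i) * h (n ∸ i)))
    ≡⟨ cong (_+_ (U 0)) (sumTo-cong n (λ i _ → pascal i)) ⟩
  U 0 + sumTo n (λ i → U (suc i) + X * T i)
    ≡⟨ cong (_+_ (U 0)) (trans (sumTo-+ n (λ i → U (suc i)) (λ i → X * T i))
                                (cong (_+_ (sumTo n (λ i → U (suc i)))) (sumTo-* n X T))) ⟩
  U 0 + (sumTo n (λ i → U (suc i)) + X * sumTo n T)
    ≡⟨ sym (+-assoc (U 0) _ _) ⟩
  (U 0 + sumTo n (λ i → U (suc i))) + X * sumTo n T
    ≡⟨ cong (_+ X * sumTo n T) (trans (sym (sumTo-head n U)) U-sum) ⟩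
  binomialSum (λ j → h (suc j)) n X + X * binomialSum h n X
    ∎
  where
  T U : ℕ → ℚ
  T i = natℚ (n C i) * ((X ^ℚ i) * h (n ∸ i))
  U i = natℚ (n C i) * ((X ^ℚ i) * h (suc n ∸ i))

  distribute : ∀ a b x y z → (a + b) * ((x * y) * z) ≡ b * ((x * y) * z) + x * (a * (y * z))
  distribute = solve-∀ ℚ-ring

  pascal : ∀ i → natℚ (suc n C suc i) * ((X ^ℚ suc i) * h (n ∸ i)) ≡ U (suc i) + X * T i
  pascal i = begin
    natℚ (suc n C suc i) * ((X ^ℚ suc i) * h (n ∸ i))
      ≡⟨ cong (λ c → natℚ c * ((X ^ℚ suc i) * h (n ∸ i))) (sym (nCk+nC[k+1]≡[n+1]C[k+1] n i)) ⟩
    natℚ (n C i ℕ.+ n C suc i) * ((X ^ℚ suc i) * h (n ∸ i))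
      ≡⟨ cong (_* ((X ^ℚ suc i) * h (n ∸ i))) (natℚ-homo-+ (n C i) (n C suc i)) ⟩
    (natℚ (n C i) + natℚ (n C suc i)) * ((X * (X ^ℚ i)) * h (n ∸ i))
      ≡⟨ distribute (natℚ (n C i)) (natℚ (n C suc i)) X (X ^ℚ i) (h (n ∸ i)) ⟩
    U (suc i) + X * T i
      ∎

  U-last : U (suc n) ≡ 0ℚ
  U-last = trans (cong (λ c → natℚ c * ((X ^ℚ suc n) * h (n ∸ n))) (k>n⇒nCk≡0 (ℕ.n<1+n n)))
                 (*-zeroˡ ((X ^ℚ suc n) * h (n ∸ n)))

  U-sum : sumTo (suc n) U ≡ binomialSum (λ j → h (suc j)) n X
  U-sum = begin
    sumTo n U + U (suc n)  ≡⟨ cong (_+_ (sumTo n U)) U-last ⟩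
    sumTo n U + 0ℚ         ≡⟨ +-identityʳ (sumTo n U) ⟩
    sumTo n U              ≡⟨ sumTo-cong n (λ i i≤n →
                                cong (λ j → natℚ (n C i) * ((X ^ℚ i) * h j)) (ℕ.+-∸-assoc 1 i≤n)) ⟩
    binomialSum (λ j → h (suc j)) n X ∎

record Recurrent (c q : ℚ) (x : ℕ → ℚ) : Set where
  constructor recurrent
  field
    step : ∀ k → x (suc (suc k)) ≡ c * x (suc k) - q * x k

binomialSum-recurrent : ∀ {h} → (∀ j → h (suc (suc j)) ≡ h (suc j) - h j) →
  ∀ X → Recurrent (X + X + 1ℚ) (X * X + (X + 1ℚ)) (λ n → binomialSum h n X)
binomialSum-recurrent {h} h-rec X = recurrent step
  where
  B : (ℕ → ℚ) → ℕ → ℚ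
  B k n = binomialSum k n X

  h′ : ℕ → ℚ
  h′ j = h (suc j)

  regroup : ∀ x a b → ((a - b) + x * a) + x * (a + x * b)
                      ≡ (x + x + 1ℚ) * (a + x * b) - (x * x + (x + 1ℚ)) * b
  regroup = solve-∀ ℚ-ring

  step : ∀ n → B h (suc (suc n)) ≡ (X + X + 1ℚ) * B h (suc n) - (X * X + (X + 1ℚ)) * B h n
  step n = begin
    B h (suc (suc n))
      ≡⟨ binomialSum-suc h (suc n) X ⟩
    B h′ (suc n) + X * B h (suc n)
      ≡⟨ cong₂ (λ u v → u + X * v) (binomialSum-suc h′ n X) (binomialSum-suc h n X) ⟩
    (B (λ j → h′ (suc j)) n + X * B h′ n) + X * (B h′ n + X * B h n)
      ≡⟨ cong (λ u → (u + X * B h′ n) + X * (B h′ n + X * B h n))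
              (trans (binomialSum-cong h-rec n X) (binomialSum-- h′ h n X)) ⟩
    ((B h′ n - B h n) + X * B h′ n) + X * (B h′ n + X * B h n)
      ≡⟨ regroup X (B h′ n) (B h n) ⟩
    (X + X + 1ℚ) * (B h′ n + X * B h n) - (X * X + (X + 1ℚ)) * B h n
      ≡⟨ cong (λ u → (X + X + 1ℚ) * u - (X * X + (X + 1ℚ)) * B h n) (sym (binomialSum-suc h n X)) ⟩
    (X + X + 1ℚ) * B h (suc n) - (X * X + (X + 1ℚ)) * B h n
      ∎

recurrent-unique : ∀ {c q x y} → Recurrent c q x → Recurrent c q y →
  x 0 ≡ y 0 → x 1 ≡ y 1 → ∀ k → x k ≡ y k
recurrent-unique {c} {q} {x} {y} (recurrent rx) (recurrent ry) e₀ e₁ = go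
  where
  go : ∀ k → x k ≡ y k
  go 0             = e₀
  go 1             = e₁
  go (suc (suc k)) =
    trans (rx k) (trans (cong₂ (λ u v → c * u - q * v) (go (suc k)) (go k)) (sym (ry k)))

recurrent-*ˡ : ∀ {c q x} a → Recurrent c q x → Recurrent c q (λ k → a * x k)
recurrent-*ˡ {c} {q} {x} a (recurrent rx) = recurrent λ k →
  trans (cong (a *_) (rx k)) (distribute a c q (x (suc k)) (x k))
  where
  distribute : ∀ a c q u v → a * (c * u - q * v) ≡ c * (a * u) - q * (a * v)
  distribute = solve-∀ ℚ-ring

recurrent-scale : ∀ {c q x} b → Recurrent c q x →
  Recurrent (c * b) (q * (b * b)) (λ k → x k * b ^ℚ k)
recurrent-scale {c} {q} {x} b (recurrent rx) = recurrent λ k →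
  trans (cong (_* b ^ℚ suc (suc k)) (rx k)) (distribute c q (x (suc k)) (x k) b (b ^ℚ k))
  where
  distribute : ∀ c q u v b w →
    (c * u - q * v) * (b * (b * w)) ≡ (c * b) * (u * (b * w)) - (q * (b * b)) * (v * w)
  distribute = solve-∀ ℚ-ring

g-rec : ∀ m j → g m (suc (suc j)) ≡ g m (suc j) - g m j
g-rec m 0 = begin - (m + 1ℚ) ≡⟨ solve (m ∷ []) ℚ-ring ⟩ - m - 1ℚ          ∎
g-rec m 1 = begin - 1ℚ       ≡⟨ solve (m ∷ []) ℚ-ring ⟩ - (m + 1ℚ) - - m   ∎
g-rec m 2 = begin m          ≡⟨ solve (m ∷ []) ℚ-ring ⟩ - 1ℚ - - (m + 1ℚ) ∎
g-rec m 3 = begin m + 1ℚ     ≡⟨ solve (m ∷ []) ℚ-ring ⟩ m - - 1ℚ           ∎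
g-rec m 4 = begin 1ℚ         ≡⟨ solve (m ∷ []) ℚ-ring ⟩ (m + 1ℚ) - m       ∎
g-rec m 5 = begin - m        ≡⟨ solve (m ∷ []) ℚ-ring ⟩ 1ℚ - (m + 1ℚ)      ∎
g-rec m (suc (suc (suc (suc (suc (suc j)))))) = g-rec m j

f-1 : ∀ m → f 1 m m ≡ 0ℚ
f-1 m = begin
  1ℚ * (1ℚ * - m) + 1ℚ * ((m * 1ℚ) * 1ℚ) ≡⟨ solve (m ∷ []) ℚ-ring ⟩
  0ℚ                                     ∎

f-2 : ∀ m → f 2 m m ≡ - (m * m + (m + 1ℚ))
f-2 m = begin
  (1ℚ * (1ℚ * - (m + 1ℚ)) + (1ℚ + 1ℚ) * ((m * 1ℚ) * - m)) + 1ℚ * ((m * (m * 1ℚ)) * 1ℚ)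
    ≡⟨ solve (m ∷ []) ℚ-ring ⟩
  - (m * m + (m + 1ℚ))
    ∎

lucasU : ℤ → ℤ → ℕ → ℤ
lucasU P Q 0             = ℤ.0ℤ
lucasU P Q 1             = ℤ.1ℤ
lucasU P Q (suc (suc k)) = P ℤ.* lucasU P Q (suc k) ℤ.- Q ℤ.* lucasU P Q k

lucasU-recurrent : ∀ P Q → Recurrent (ι P) (ι Q) (λ k → ι (lucasU P Q k))
lucasU-recurrent P Q = recurrent λ k →
  trans (ι-homo-- (P ℤ.* lucasU P Q (suc k)) (Q ℤ.* lucasU P Q k))
        (cong₂ _-_ (ι-homo-* P (lucasU P Q (suc k))) (ι-homo-* Q (lucasU P Q k)))

infix 4 _∥_
_∥_ : ℤ → ℤ → Set
k ∥ i = k ∣ i × ¬ k ℤ.* k ∣ i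

∤-neg : ∀ {k i} → ¬ k ∣ i → ¬ k ∣ ℤ.- i
∤-neg {k} {i} k∤i k∣-i = k∤i (subst (k ∣_) (ℤ.neg-involutive i) (∣m⇒∣-m k∣-i))

∥-neg : ∀ {k i} → k ∥ i → k ∥ ℤ.- i
∥-neg (k∣i , k²∤i) = ∣m⇒∣-m k∣i , ∤-neg k²∤i

module _ {p : ℕ} (p-prime : Prime p) where
  private
    instance
      +p≢0 : ℤ.NonZero (+ p)
      +p≢0 = prime⇒nonZero p-prime

    p≢1 : p ≢ 1
    p≢1 = ℕ.nonTrivial⇒≢1 {{prime⇒nonTrivial p-prime}}

    ∣p²∣≡p^2 : ℤ.∣ + p ℤ.* + p ∣ ≡ p ℕ.^ 2
    ∣p²∣≡p^2 = trans (ℤ.abs-* (+ p) (+ p)) (cong (p ℕ.*_) (sym (ℕ.*-identityʳ p)))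

  ∣prime⇒≡ : ∀ {q} → Prime q → + p ∣ + q → p ≡ q
  ∣prime⇒≡ q-prime p∣q =
    [ (λ p≡1 → contradiction p≡1 p≢1) , id ]′ (prime⇒irreducible q-prime (∣⇒∣ᵤ p∣q))

  ∤1 : ¬ + p ∣ ℤ.1ℤ
  ∤1 p∣1 = p≢1 (ℕ.∣1⇒≡1 (∣⇒∣ᵤ p∣1))

  ∣m*n⇒∣m⊎∣n : ∀ i j → + p ∣ i ℤ.* j → + p ∣ i ⊎ + p ∣ j
  ∣m*n⇒∣m⊎∣n i j p∣ij = Sum.map ∣ᵤ⇒∣ ∣ᵤ⇒∣
    (euclidsLemma ℤ.∣ i ∣ ℤ.∣ j ∣ p-prime (subst (p ℕ.∣_) (ℤ.abs-* i j) (∣⇒∣ᵤ p∣ij)))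

  ∣m*n∧∤n⇒∣m : ∀ {i j} → + p ∣ i ℤ.* j → ¬ + p ∣ j → + p ∣ i
  ∣m*n∧∤n⇒∣m {i} {j} p∣ij p∤j =
    [ id , (λ p∣j → contradiction p∣j p∤j) ]′ (∣m*n⇒∣m⊎∣n i j p∣ij)

  ∤m∧∤n⇒∤m*n : ∀ {i j} → ¬ + p ∣ i → ¬ + p ∣ j → ¬ + p ∣ i ℤ.* j
  ∤m∧∤n⇒∤m*n p∤i p∤j p∣ij = p∤i (∣m*n∧∤n⇒∣m p∣ij p∤j)

  ∤^ : ∀ {i} → ¬ + p ∣ i → ∀ k → ¬ + p ∣ i ℤ.^ k
  ∤^ p∤i zero    = ∤1
  ∤^ p∤i (suc k) = ∤m∧∤n⇒∤m*n p∤i (∤^ p∤i k)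

  p*p∣m*n∧∤n⇒p*p∣m : ∀ {i j} → + p ℤ.* + p ∣ i ℤ.* j → ¬ + p ∣ j → + p ℤ.* + p ∣ i
  p*p∣m*n∧∤n⇒p*p∣m {i} {j} p²∣ij p∤j
    with ∣m*n∧∤n⇒∣m {i} {j} (∣-trans (∣m⇒∣m*n (+ p) ∣-refl) p²∣ij) p∤j
  ... | divides q refl = *-monoˡ-∣ (+ p) p∣q
    where
    swap : ∀ a b c → (a ℤ.* b) ℤ.* c ≡ (a ℤ.* c) ℤ.* b
    swap = ℤ-Solver.solve-∀

    p∣q : + p ∣ q
    p∣q = ∣m*n∧∤n⇒∣m {q} {j}
      (*-cancelʳ-∣ (+ p) (subst (+ p ℤ.* + p ∣_) (swap q (+ p) j) p²∣ij)) p∤j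

  ∥-* : ∀ {i j} → + p ∥ i → ¬ + p ∣ j → + p ∥ i ℤ.* j
  ∥-* {i} {j} (p∣i , p²∤i) p∤j =
    ∣m⇒∣m*n j p∣i , λ p²∣ij → p²∤i (p*p∣m*n∧∤n⇒p*p∣m p²∣ij p∤j)

  ∥-transfer : ∀ {u y i e} → u ℤ.* y ≡ i ℤ.* e → ¬ + p ∣ y → ¬ + p ∣ e → + p ∥ u → + p ∥ i
  ∥-transfer {u} {y} {i} {e} uy≡ie p∤y p∤e (p∣u , p²∤u) =
      ∣m*n∧∤n⇒∣m (subst (+ p ∣_) uy≡ie (∣m⇒∣m*n y p∣u)) p∤e
    , λ p²∣i → p²∤u (p*p∣m*n∧∤n⇒p*p∣m (subst (+ p ℤ.* + p ∣_) (sym uy≡ie) (∣m⇒∣m*n e p²∣i)) p∤y)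

  lucasU-indivisible : ∀ {P Q} → ¬ + p ∣ P → + p ∣ Q → ∀ k → ¬ + p ∣ lucasU P Q (suc k)
  lucasU-indivisible p∤P p∣Q zero = ∤1
  lucasU-indivisible {P} {Q} p∤P p∣Q (suc k) p∣U = ∤m∧∤n⇒∤m*n p∤P (lucasU-indivisible p∤P p∣Q k)
    (∣m+n∣n⇒∣m p∣U (∣m⇒∣-m (∣m⇒∣m*n (lucasU P Q k) p∣Q)))

  ∣↥⇒∤↧ : ∀ x → + p ∣ ↥ x → ¬ + p ∣ ↧ x
  ∣↥⇒∤↧ (mkℚ n d-1 coprime) p∣n p∣d =
    p≢1 (Coprimality.recompute coprime (∣⇒∣ᵤ p∣n , ∣⇒∣ᵤ p∣d))

  ∤↧ : ∀ x i j → x * ι j ≡ ι i → ¬ + p ∣ j → ¬ + p ∣ ↧ x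
  ∤↧ x i j eq p∤j p∣↧x = ∣↥⇒∤↧ x p∣↥x p∣↧x
    where
    p∣↥x : + p ∣ ↥ x
    p∣↥x = ∣m*n∧∤n⇒∣m (subst (+ p ∣_) (sym (*ι≡ι⇒cross x i j eq)) (∣n⇒∣m*n i p∣↧x)) p∤j

  hasValuation-1⇒∥↥ : ∀ x → HasValuation p x (+ 1) → + p ∥ ↥ x × ¬ + p ∣ ↧ x
  hasValuation-1⇒∥↥ x (_ , p∣↥x , p²∤↥x , p∤↧x) =
      ( ∣ᵤ⇒∣ (subst (ℕ._∣ ℤ.∣ ↥ x ∣) (ℕ.*-identityʳ p) p∣↥x)
      , λ p²∣↥x → p²∤↥x (subst (ℕ._∣ ℤ.∣ ↥ x ∣) ∣p²∣≡p^2 (∣⇒∣ᵤ p²∣↥x)))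
    , p∤↧x ∘ ∣⇒∣ᵤ

  ∥↥⇒hasValuation-1 : ∀ x → + p ∥ ↥ x → ¬ + p ∣ ↧ x → HasValuation p x (+ 1)
  ∥↥⇒hasValuation-1 x (p∣↥x , p²∤↥x) p∤↧x =
      (λ x≡0 → p²∤↥x (subst (+ p ℤ.* + p ∣_) (sym (p≡0⇒↥p≡0 x x≡0)) (∣ᵤ⇒∣ (_ ℕ.∣0))))
    , subst (ℕ._∣ ℤ.∣ ↥ x ∣) (sym (ℕ.*-identityʳ p)) (∣⇒∣ᵤ p∣↥x)
    , (λ p²∣↥x → p²∤↥x (∣ᵤ⇒∣ (subst (ℕ._∣ ℤ.∣ ↥ x ∣) (sym ∣p²∣≡p^2) p²∣↥x)))
    , p∤↧x ∘ ∣ᵤ⇒∣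

  hasValuation-1⇒∥ : ∀ x i j → x * ι j ≡ ι i → ¬ + p ∣ j → HasValuation p x (+ 1) → + p ∥ i
  hasValuation-1⇒∥ x i j eq p∤j v with hasValuation-1⇒∥↥ x v
  ... | p∥↥x , p∤↧x = ∥-transfer (*ι≡ι⇒cross x i j eq) p∤j p∤↧x p∥↥x

  ∥⇒hasValuation-1 : ∀ x i j → x * ι j ≡ ι i → ¬ + p ∣ j → + p ∥ i → HasValuation p x (+ 1)
  ∥⇒hasValuation-1 x i j eq p∤j p∥i =
    ∥↥⇒hasValuation-1 x (∥-transfer (sym (*ι≡ι⇒cross x i j eq)) p∤↧x p∤j p∥i) p∤↧x
    where
    p∤↧x : ¬ + p ∣ ↧ x
    p∤↧x = ∤↧ x i j eq p∤j

module _ (m : ℚ) where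
  private
    a d P Q : ℤ
    a = ↥ m
    d = ↧ m
    P = a ℤ.+ a ℤ.+ d
    Q = a ℤ.* a ℤ.+ (a ℤ.* d ℤ.+ d ℤ.* d)

    N : ℚ
    N = m * m + (m + 1ℚ)

  P-homogenisation : (m + m + 1ℚ) * ι d ≡ ι P
  P-homogenisation = begin
    (m + m + 1ℚ) * ι d         ≡⟨ expand m (ι d) ⟩
    (m * ι d + m * ι d) + ι d  ≡⟨ cong (λ u → (u + u) + ι d) (*ι↧≡ι↥ m) ⟩
    (ι a + ι a) + ι d          ≡⟨ sym (trans (ι-homo-+ (a ℤ.+ a) d) (cong (_+ ι d) (ι-homo-+ a a))) ⟩
    ι P                        ∎
    where
    expand : ∀ x b → (x + x + 1ℚ) * b ≡ (x * b + x * b) + b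
    expand = solve-∀ ℚ-ring

  Q-homogenisation : N * (ι d * ι d) ≡ ι Q
  Q-homogenisation = begin
    N * (ι d * ι d)
      ≡⟨ expand m (ι d) ⟩
    (m * ι d) * (m * ι d) + ((m * ι d) * ι d + ι d * ι d)
      ≡⟨ cong (λ u → u * u + (u * ι d + ι d * ι d)) (*ι↧≡ι↥ m) ⟩
    ι a * ι a + (ι a * ι d + ι d * ι d)
      ≡⟨ sym ι-Q ⟩
    ι Q
      ∎
    where
    expand : ∀ x b → (x * x + (x + 1ℚ)) * (b * b) ≡ (x * b) * (x * b) + ((x * b) * b + b * b)
    expand = solve-∀ ℚ-ring

    ι-Q : ι Q ≡ ι a * ι a + (ι a * ι d + ι d * ι d)
    ι-Q = trans (ι-homo-+ (a ℤ.* a) (a ℤ.* d ℤ.+ d ℤ.* d)) (cong₂ _+_ (ι-homo-* a a)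
            (trans (ι-homo-+ (a ℤ.* d) (d ℤ.* d)) (cong₂ _+_ (ι-homo-* a d) (ι-homo-* d d))))

  f-homogenisation : ∀ k → f (suc k) m m * ι (d ℤ.^ suc k) ≡ ι (ℤ.- Q ℤ.* lucasU P Q k)
  f-homogenisation k = begin
    f (suc k) m m * ι (d ℤ.^ suc k)  ≡⟨ cong (f (suc k) m m *_) (ι-homo-^ d (suc k)) ⟩
    F k                              ≡⟨ recurrent-unique F-recurrent U-recurrent initial₀ initial₁ k ⟩
    U k                              ≡⟨ cong (_* ι (lucasU P Q k)) (sym (ι-homo‿- Q)) ⟩
    ι (ℤ.- Q) * ι (lucasU P Q k)     ≡⟨ sym (ι-homo-* (ℤ.- Q) (lucasU P Q k)) ⟩
    ι (ℤ.- Q ℤ.* lucasU P Q k)       ∎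
    where
    F U : ℕ → ℚ
    F k = f (suc k) m m * ι d ^ℚ suc k
    U k = - ι Q * ι (lucasU P Q k)

    F-recurrent : Recurrent (ι P) (ι Q) F
    F-recurrent = recurrent λ k → Recurrent.step
      (subst₂ (λ c q → Recurrent c q (λ k → f k m m * ι d ^ℚ k)) P-homogenisation Q-homogenisation
        (recurrent-scale (ι d) (binomialSum-recurrent {g m} (g-rec m) m)))
      (suc k)

    U-recurrent : Recurrent (ι P) (ι Q) U
    U-recurrent = recurrent-*ˡ (- ι Q) (lucasU-recurrent P Q)

    initial₀ : F 0 ≡ U 0
    initial₀ = trans (cong (_* (ι d * 1ℚ)) (f-1 m))
                     (trans (*-zeroˡ (ι d * 1ℚ)) (sym (*-zeroʳ (- ι Q))))

    regroup : ∀ x b → - x * (b * (b * 1ℚ)) ≡ - (x * (b * b)) * 1ℚ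
    regroup = solve-∀ ℚ-ring

    initial₁ : F 1 ≡ U 1
    initial₁ = begin
      f 2 m m * (ι d * (ι d * 1ℚ))  ≡⟨ cong (_* (ι d * (ι d * 1ℚ))) (f-2 m) ⟩
      - N * (ι d * (ι d * 1ℚ))      ≡⟨ regroup N (ι d) ⟩
      - (N * (ι d * ι d)) * 1ℚ      ≡⟨ cong (λ u → - u * 1ℚ) Q-homogenisation ⟩
      - ι Q * 1ℚ                    ∎

  module _ {p} (p-prime : Prime p) (p≢3 : p ≢ 3) (v[N]≡1 : HasValuation p N (+ 1)) where
    private
      Q-homogenisationℤ : N * ι (d ℤ.* d) ≡ ι Q
      Q-homogenisationℤ = trans (cong (N *_) (ι-homo-* d d)) Q-homogenisation

    p∤d : ¬ + p ∣ d
    p∤d p∣d = ∣↥⇒∤↧ p-prime m p∣a p∣d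
      where
      p∣Q : + p ∣ Q
      p∣Q = ∣m*n∧∤n⇒∣m p-prime
        (subst (+ p ∣_) (*ι≡ι⇒cross N Q (d ℤ.* d) Q-homogenisationℤ) (∣n⇒∣m*n (↥ N) (∣m⇒∣m*n d p∣d)))
        (proj₂ (hasValuation-1⇒∥↥ p-prime N v[N]≡1))

      p∣a : + p ∣ a
      p∣a = [ id , id ]′ (∣m*n⇒∣m⊎∣n p-prime a a
        (∣m+n∣n⇒∣m p∣Q (∣m∣n⇒∣m+n (∣n⇒∣m*n a p∣d) (∣n⇒∣m*n d p∣d))))

    p∥Q : + p ∥ Q
    p∥Q = hasValuation-1⇒∥ p-prime N Q (d ℤ.* d) Q-homogenisationℤ
      (∤m∧∤n⇒∤m*n p-prime p∤d p∤d) v[N]≡1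

    p∤P : ¬ + p ∣ P
    p∤P p∣P = ∤m∧∤n⇒∤m*n p-prime p∤3 (∤m∧∤n⇒∤m*n p-prime p∤d p∤d) p∣3d²
      where
      complete-square : ∀ a d → (a ℤ.+ a ℤ.+ d) ℤ.* (a ℤ.+ a ℤ.+ d) ℤ.+ + 3 ℤ.* (d ℤ.* d)
                                ≡ + 4 ℤ.* (a ℤ.* a ℤ.+ (a ℤ.* d ℤ.+ d ℤ.* d))
      complete-square = ℤ-Solver.solve-∀

      p∤3 : ¬ + p ∣ + 3
      p∤3 = p≢3 ∘ ∣prime⇒≡ p-prime (from-yes (prime? 3))

      p∣3d² : + p ∣ + 3 ℤ.* (d ℤ.* d)
      p∣3d² = ∣m+n∣m⇒∣n
        (subst (+ p ∣_) (sym (complete-square a d)) (∣n⇒∣m*n (+ 4) (proj₁ p∥Q)))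
        (∣m⇒∣m*n P p∣P)

    f-hasValuation-1 : ∀ k → HasValuation p (f (suc (suc k)) m m) (+ 1)
    f-hasValuation-1 k = ∥⇒hasValuation-1 p-prime (f (suc (suc k)) m m) _ (d ℤ.^ suc (suc k))
      (f-homogenisation (suc k))
      (∤^ p-prime p∤d (suc (suc k)))
      (∥-* p-prime (∥-neg p∥Q) (lucasU-indivisible p-prime p∤P (proj₁ p∥Q) k))

mainTheorem8 : (m : ℚ) (n : ℕ) → n ≥ 2 → (p : ℕ) → Prime p → p ≢ 3 →
    HasValuation p ((m * m) + (m + 1ℚ)) (+ 1) →
    HasValuation p (f n m m) (+ 1)
mainTheorem8 m (suc (suc k)) _ p p-prime p≢3 v[N]≡1 = f-hasValuation-1 m p-prime p≢3 v[N]≡1 k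
mainTheorem8 m 1 (s≤s ())
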